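{- Let $A$ be a $\delta$-algebra and let $x_1,x_2,\ldots$ be elements of $\mathrm{Rad}\,A$. Then $\delta(x_1,x_2,\ldots)\in\mathrm{Rad}\,A$.
   Context: An MV-algebra is a structure $(A,\oplus,\neg,0)$ such that $(A,\oplus,0)$ is a commutative monoid, $\neg\neg x=x$, $x\oplus\neg 0=\neg 0$, and $\neg(\neg x\oplus y)\oplus y=\neg(\neg y\oplus x)\oplus x$. Write $1:=\neg 0$, $x\odot y:=\neg(\neg x\oplus\neg y)$, $x\ominus y:=x\odot\neg y$, $d(x,y):=(x\ominus y)\oplus(y\ominus x)$; $x\le y$ iff $x\ominus y=0$ defines a lattice order with $x\vee y=\neg(\neg x\oplus y)\oplus y$. An ideal is a subset containing $0$, downward closed and closed under $\oplus$; $\mathrm{Rad}\,A$ is the intersection of all maximal (proper) ideals of the underlying MV-algebra of $A$. A $\delta$-algebra is a structure $(A,\delta,\oplus,\neg,0)$ where $(A,\oplus,\neg,0)$ is an MV-algebra and $\delta$ is an operation of countably infinite arity such that, writing $\vec x=(x_1,x_2,\ldots)$, $\vec 0=(0,0,\ldots)$ and $f_{1/2}(x):=\delta(x,\vec 0)$: (A1) $d(\delta(\vec x),\delta(x_1,\vec 0))=\delta(0,x_2,x_3,\ldots)$; (A2) $f_{1/2}(\delta(\vec x))=\delta(f_{1/2}(x_1),f_{1/2}(x_2),\ldots)$; (A3) $\delta(x,x,\ldots)=x$; (A4) $\delta(0,\vec x)=f_{1/2}(\delta(\vec x))$; (A5) $\delta(x_1\oplus y_1,x_2\oplus y_2,\ldots)\ge\delta(x_1,x_2,\ldots)$;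 (A6) $f_{1/2}(x\ominus y)=f_{1/2}(x)\ominus f_{1/2}(y)$. -}

module Defs where

open import Level using (Level; suc; _⊔_)
open import Data.Nat using (ℕ; zero) renaming (suc to sucℕ)
open import Data.Sum using (_⊎_)
open import Relation.Nullary using (¬_)
open import Relation.Binary.PropositionalEquality using (_≡_)
open import Relation.Unary using (Pred; _∈_; _⊆_)

-- Sequences x = (x₁, x₂, …) are functions ℕ → A, with x 0 playing the role of x₁.
Seq : ∀ {a} → Set a → Set a
Seq A = ℕ → A

_∷ₛ_ : ∀ {a} {A : Set a} → A → Seq A → Seq A
(y ∷ₛ x) zero     = y
(y ∷ₛ x) (sucℕ n) = x n

tailₛ : ∀ {a} {A : Set a} → Seq A → Seq A
tailₛ x n = x (sucℕ n)

constₛ : ∀ {a} {A : Set a} → A → Seq A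
constₛ y _ = y

record DeltaAlgebra (a : Level) : Set (suc a) where
  infixl 6 _⊕_ _⊙_ _⊖_
  infix 4 _≤_
  field
    Carrier : Set a
    δ   : Seq Carrier → Carrier
    _⊕_ : Carrier → Carrier → Carrier
    ∼_  : Carrier → Carrier
    𝟘   : Carrier

  𝟙 : Carrier
  𝟙 = ∼ 𝟘

  _⊙_ : Carrier → Carrier → Carrier
  x ⊙ y = ∼ ((∼ x) ⊕ (∼ y))

  _⊖_ : Carrier → Carrier → Carrier
  x ⊖ y = x ⊙ (∼ y)

  d : Carrier → Carrier → Carrier
  d x y = (x ⊖ y) ⊕ (y ⊖ x)

  _≤_ : Carrier → Carrier → Set a
  x ≤ y = x ⊖ y ≡ 𝟘

  f½ : Carrier → Carrier
  f½ x = δ (x ∷ₛ constₛ 𝟘)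

  field
    ⊕-assoc     : ∀ x y z → (x ⊕ y) ⊕ z ≡ x ⊕ (y ⊕ z)
    ⊕-comm      : ∀ x y → x ⊕ y ≡ y ⊕ x
    ⊕-identityʳ : ∀ x → x ⊕ 𝟘 ≡ x
    ∼-involutive : ∀ x → ∼ (∼ x) ≡ x
    ⊕-absorb    : ∀ x → x ⊕ 𝟙 ≡ 𝟙
    łuk         : ∀ x y → ∼ ((∼ x) ⊕ y) ⊕ y ≡ ∼ ((∼ y) ⊕ x) ⊕ x
    A1 : ∀ (x : Seq Carrier) →
           d (δ x) (δ (x zero ∷ₛ constₛ 𝟘)) ≡ δ (𝟘 ∷ₛ tailₛ x)
    A2 : ∀ (x : Seq Carrier) → f½ (δ x) ≡ δ (λ n → f½ (x n))
    A3 : ∀ x → δ (constₛ x) ≡ x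
    A4 : ∀ (x : Seq Carrier) → δ (𝟘 ∷ₛ x) ≡ f½ (δ x)
    A5 : ∀ (x y : Seq Carrier) → δ x ≤ δ (λ n → x n ⊕ y n)
    A6 : ∀ x y → f½ (x ⊖ y) ≡ f½ x ⊖ f½ y

module _ {a : Level} (A : DeltaAlgebra a) where
  open DeltaAlgebra A

  record IsIdeal (I : Pred Carrier a) : Set a where
    field
      zero∈   : 𝟘 ∈ I
      down    : ∀ {x y} → x ≤ y → y ∈ I → x ∈ I
      ⊕-closed : ∀ {x y} → x ∈ I → y ∈ I → (x ⊕ y) ∈ I

  IsProper : Pred Carrier a → Set a
  IsProper I = ¬ (∀ x → x ∈ I)

  record IsMaximalIdeal (M : Pred Carrier a) : Set (suc a) where
    field
      ideal   : IsIdeal M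
      proper  : IsProper M
      maximal : ∀ (J : Pred Carrier a) → IsIdeal J → M ⊆ J → IsProper J → J ⊆ M

  Rad : Carrier → Set (suc a)
  Rad x = ∀ (M : Pred Carrier a) → IsMaximalIdeal M → x ∈ M

-- Fix a maximal ideal M. Axioms A1 and A4 give δ(x) ≤ f½(x₁) ⊕ f½(δ(x₂, x₃, …)), and
-- f½ really halves (f½ y ⊕ f½ y = y, f½ y ≤ y), so iterating n times yields
-- δ(x) ≤ m ⊕ 2⁻ⁿ for some m ∈ M. The elements lying within 2⁻ⁿ of M for every n form an
-- ideal containing M; it is proper, since otherwise 1 ≤ m ⊕ ½ forces ½ ∈ M and then
-- 1 = ½ ⊕ ½ ∈ M. By maximality it equals M, so δ(x) ∈ M.
module Submission where

open import Algebra.Bundles using (CommutativeSemigroup)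
open import Data.Nat using (ℕ; zero; suc)
open import Data.Product using (Σ-syntax; _×_; _,_)
open import Level using (Level)
open import Relation.Binary.PropositionalEquality
open import Relation.Binary.PropositionalEquality.Algebra using (isMagma)
open import Relation.Unary using (Pred; _∈_; _⊆_)

open import Defs

module _ {a : Level} (A : DeltaAlgebra a) where
  open DeltaAlgebra A
  open ≡-Reasoning

  ⊕-commutativeSemigroup : CommutativeSemigroup a a
  ⊕-commutativeSemigroup = record
    { isCommutativeSemigroup = record
      { isSemigroup = record { isMagma = isMagma _⊕_ ; assoc = ⊕-assoc }
      ; comm        = ⊕-comm
      }
    }

  open import Algebra.Properties.CommutativeSemigroup ⊕-commutativeSemigroup
    using (interchange; xy∙z≈xz∙y)

  ⊕-identityˡ : ∀ x → 𝟘 ⊕ x ≡ x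
  ⊕-identityˡ x = trans (⊕-comm 𝟘 x) (⊕-identityʳ x)

  ⊕-zeroˡ : ∀ x → 𝟙 ⊕ x ≡ 𝟙
  ⊕-zeroˡ x = trans (⊕-comm 𝟙 x) (⊕-absorb x)

  ∼𝟙≡𝟘 : ∼ 𝟙 ≡ 𝟘
  ∼𝟙≡𝟘 = ∼-involutive 𝟘

  ⊕-complementˡ : ∀ x → ∼ x ⊕ x ≡ 𝟙
  ⊕-complementˡ x = begin
    ∼ x ⊕ x               ≡⟨ cong (λ t → ∼ t ⊕ x) (sym (⊕-identityˡ x)) ⟩
    ∼ (𝟘 ⊕ x) ⊕ x         ≡⟨ cong (λ t → ∼ (t ⊕ x) ⊕ x) (sym ∼𝟙≡𝟘) ⟩
    ∼ (∼ 𝟙 ⊕ x) ⊕ x       ≡⟨ sym (łuk x 𝟙) ⟩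
    ∼ (∼ x ⊕ 𝟙) ⊕ 𝟙       ≡⟨ ⊕-absorb _ ⟩
    𝟙                     ∎

  ∼-⊖ : ∀ x y → ∼ (x ⊖ y) ≡ ∼ x ⊕ y
  ∼-⊖ x y = trans (∼-involutive _) (cong (∼ x ⊕_) (∼-involutive y))

  𝟙⊖x≡∼x : ∀ x → 𝟙 ⊖ x ≡ ∼ x
  𝟙⊖x≡∼x x = cong ∼_ (begin
    ∼ 𝟙 ⊕ ∼ (∼ x)  ≡⟨ cong (_⊕ ∼ (∼ x)) ∼𝟙≡𝟘 ⟩
    𝟘 ⊕ ∼ (∼ x)    ≡⟨ ⊕-identityˡ _ ⟩
    ∼ (∼ x)        ≡⟨ ∼-involutive x ⟩
    x              ∎)

  -- Equivalent to _≤_ (see ≤⇒≼ and ≼⇒≤), but in the shape on which ⊕-absorb and łuk act.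
  infix 4 _≼_
  _≼_ : Carrier → Carrier → Set a
  x ≼ y = ∼ x ⊕ y ≡ 𝟙

  ≤⇒≼ : ∀ {x y} → x ≤ y → x ≼ y
  ≤⇒≼ {x} {y} x≤y = begin
    ∼ x ⊕ y                 ≡⟨ cong (∼ x ⊕_) (sym (∼-involutive y)) ⟩
    ∼ x ⊕ ∼ (∼ y)           ≡⟨ sym (∼-involutive _) ⟩
    ∼ (∼ (∼ x ⊕ ∼ (∼ y)))   ≡⟨ cong ∼_ x≤y ⟩
    𝟙                       ∎

  ≼⇒≤ : ∀ {x y} → x ≼ y → x ≤ y
  ≼⇒≤ {x} {y} x≼y = begin
    ∼ (∼ x ⊕ ∼ (∼ y))  ≡⟨ cong (λ t → ∼ (∼ x ⊕ t)) (∼-involutive y) ⟩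
    ∼ (∼ x ⊕ y)        ≡⟨ cong ∼_ x≼y ⟩
    ∼ 𝟙                ≡⟨ ∼𝟙≡𝟘 ⟩
    𝟘                  ∎

  ≼-refl : ∀ x → x ≼ x
  ≼-refl = ⊕-complementˡ

  ≼-maximum : ∀ x → x ≼ 𝟙
  ≼-maximum x = ⊕-absorb _

  ≼-minimum : ∀ x → 𝟘 ≼ x
  ≼-minimum = ⊕-zeroˡ

  𝟙≼x⇒x≡𝟙 : ∀ {x} → 𝟙 ≼ x → x ≡ 𝟙
  𝟙≼x⇒x≡𝟙 {x} 𝟙≼x = trans (sym (⊕-identityˡ x)) (trans (cong (_⊕ x) (sym ∼𝟙≡𝟘)) 𝟙≼x)

  x≼x⊕y : ∀ x y → x ≼ x ⊕ y
  x≼x⊕y x y = begin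
    ∼ x ⊕ (x ⊕ y)  ≡⟨ sym (⊕-assoc _ _ _) ⟩
    (∼ x ⊕ x) ⊕ y  ≡⟨ cong (_⊕ y) (⊕-complementˡ x) ⟩
    𝟙 ⊕ y          ≡⟨ ⊕-zeroˡ y ⟩
    𝟙              ∎

  ≼-trans : ∀ {x y z} → x ≼ y → y ≼ z → x ≼ z
  ≼-trans {x} {y} {z} x≼y y≼z = begin
    ∼ x ⊕ z                    ≡⟨ cong (∼ x ⊕_) (sym (⊕-identityˡ z)) ⟩
    ∼ x ⊕ (𝟘 ⊕ z)              ≡⟨ cong (λ t → ∼ x ⊕ (t ⊕ z)) (sym (≼⇒≤ y≼z)) ⟩
    ∼ x ⊕ (∼ (∼ y ⊕ ∼ (∼ z)) ⊕ z)
      ≡⟨ cong (λ t → ∼ x ⊕ (∼ (∼ y ⊕ t) ⊕ z)) (∼-involutive z) ⟩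
    ∼ x ⊕ (∼ (∼ y ⊕ z) ⊕ z)    ≡⟨ cong (∼ x ⊕_) (łuk y z) ⟩
    ∼ x ⊕ (∼ (∼ z ⊕ y) ⊕ y)    ≡⟨ cong (∼ x ⊕_) (⊕-comm _ _) ⟩
    ∼ x ⊕ (y ⊕ ∼ (∼ z ⊕ y))    ≡⟨ sym (⊕-assoc _ _ _) ⟩
    (∼ x ⊕ y) ⊕ ∼ (∼ z ⊕ y)    ≡⟨ cong (_⊕ ∼ (∼ z ⊕ y)) x≼y ⟩
    𝟙 ⊕ ∼ (∼ z ⊕ y)            ≡⟨ ⊕-zeroˡ _ ⟩
    𝟙                          ∎

  x⊕[y⊖x]≡y : ∀ {x y} → x ≼ y → x ⊕ (y ⊖ x) ≡ y
  x⊕[y⊖x]≡y {x} {y} x≼y = begin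
    x ⊕ ∼ (∼ y ⊕ ∼ (∼ x))  ≡⟨ cong (λ t → x ⊕ ∼ (∼ y ⊕ t)) (∼-involutive x) ⟩
    x ⊕ ∼ (∼ y ⊕ x)        ≡⟨ ⊕-comm _ _ ⟩
    ∼ (∼ y ⊕ x) ⊕ x        ≡⟨ łuk y x ⟩
    ∼ (∼ x ⊕ y) ⊕ y        ≡⟨ cong (λ t → ∼ t ⊕ y) x≼y ⟩
    ∼ 𝟙 ⊕ y                ≡⟨ cong (_⊕ y) ∼𝟙≡𝟘 ⟩
    𝟘 ⊕ y                  ≡⟨ ⊕-identityˡ y ⟩
    y                      ∎

  ⊕-monoˡ-≼ : ∀ {x y} z → x ≼ y → x ⊕ z ≼ y ⊕ z
  ⊕-monoˡ-≼ {x} {y} z x≼y =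
    subst (λ t → x ⊕ z ≼ t ⊕ z) (x⊕[y⊖x]≡y x≼y)
      (subst (x ⊕ z ≼_) (sym (xy∙z≈xz∙y x (y ⊖ x) z)) (x≼x⊕y (x ⊕ z) (y ⊖ x)))

  ⊕-mono-≼ : ∀ {x y u v} → x ≼ y → u ≼ v → x ⊕ u ≼ y ⊕ v
  ⊕-mono-≼ {x} {y} {u} {v} x≼y u≼v = ≼-trans (⊕-monoˡ-≼ u x≼y)
    (subst₂ _≼_ (⊕-comm u y) (⊕-comm v y) (⊕-monoˡ-≼ y u≼v))

  ⊖≼⇒≼⊕ : ∀ {x y z} → x ⊖ y ≼ z → x ≼ y ⊕ z
  ⊖≼⇒≼⊕ {x} {y} {z} x⊖y≼z =
    trans (sym (⊕-assoc _ _ _)) (trans (cong (_⊕ z) (sym (∼-⊖ x y))) x⊖y≼z)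

  ≼⊕⇒⊖≼ : ∀ {x y z} → x ≼ y ⊕ z → x ⊖ y ≼ z
  ≼⊕⇒⊖≼ {x} {y} {z} x≼y⊕z = trans (cong (_⊕ z) (∼-⊖ x y)) (trans (⊕-assoc _ _ _) x≼y⊕z)

  ∼-cancel-≼ : ∀ {x y} → ∼ y ≼ ∼ x → x ≼ y
  ∼-cancel-≼ {x} {y} ∼y≼∼x =
    trans (⊕-comm _ _) (trans (cong (_⊕ ∼ x) (sym (∼-involutive y))) ∼y≼∼x)

  x≼y⊕d[x,y] : ∀ x y → x ≼ y ⊕ d x y
  x≼y⊕d[x,y] x y = ≼-trans (⊖≼⇒≼⊕ (≼-refl (x ⊖ y)))
    (subst (y ⊕ (x ⊖ y) ≼_) (⊕-assoc _ _ _) (x≼x⊕y _ _))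

  f½-zero : f½ 𝟘 ≡ 𝟘
  f½-zero = begin
    f½ 𝟘            ≡⟨ cong f½ (sym (≼⇒≤ (≼-refl 𝟘))) ⟩
    f½ (𝟘 ⊖ 𝟘)      ≡⟨ A6 𝟘 𝟘 ⟩
    f½ 𝟘 ⊖ f½ 𝟘     ≡⟨ ≼⇒≤ (≼-refl _) ⟩
    𝟘               ∎

  f½-mono-≼ : ∀ {x y} → x ≼ y → f½ x ≼ f½ y
  f½-mono-≼ {x} {y} x≼y =
    ≤⇒≼ (trans (sym (A6 x y)) (trans (cong f½ (≼⇒≤ x≼y)) f½-zero))

  d[x,f½x]≡f½x : ∀ x → d x (f½ x) ≡ f½ x
  d[x,f½x]≡f½x x = begin
    d x (f½ x)                 ≡⟨ cong (λ t → d t (f½ x)) (sym (A3 x)) ⟩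
    d (δ (constₛ x)) (f½ x)    ≡⟨ A1 (constₛ x) ⟩
    δ (𝟘 ∷ₛ constₛ x)          ≡⟨ A4 (constₛ x) ⟩
    f½ (δ (constₛ x))          ≡⟨ cong f½ (A3 x) ⟩
    f½ x                       ∎

  ½ : Carrier
  ½ = f½ 𝟙

  ∼½≡½ : ∼ ½ ≡ ½
  ∼½≡½ = begin
    ∼ ½                ≡⟨ sym (⊕-identityʳ _) ⟩
    ∼ ½ ⊕ 𝟘            ≡⟨ cong₂ _⊕_ (sym (𝟙⊖x≡∼x ½)) (sym (≼⇒≤ (≼-maximum ½))) ⟩
    (𝟙 ⊖ ½) ⊕ (½ ⊖ 𝟙)  ≡⟨ d[x,f½x]≡f½x 𝟙 ⟩
    ½                  ∎

  f½-∼ : ∀ x → f½ (∼ x) ≡ ∼ (½ ⊕ f½ x)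
  f½-∼ x = begin
    f½ (∼ x)                 ≡⟨ cong f½ (sym (𝟙⊖x≡∼x x)) ⟩
    f½ (𝟙 ⊖ x)               ≡⟨ A6 𝟙 x ⟩
    ∼ (∼ ½ ⊕ ∼ (∼ (f½ x)))   ≡⟨ cong₂ (λ s t → ∼ (s ⊕ t)) ∼½≡½ (∼-involutive _) ⟩
    ∼ (½ ⊕ f½ x)             ∎

  x≼f½x⊕½ : ∀ x → x ≼ f½ x ⊕ ½
  x≼f½x⊕½ x = ⊖≼⇒≼⊕ (≼-trans x⊖f½x≼f½x (f½-mono-≼ (≼-maximum x)))
    where
    x⊖f½x≼f½x : x ⊖ f½ x ≼ f½ x
    x⊖f½x≼f½x = subst (x ⊖ f½ x ≼_) (d[x,f½x]≡f½x x) (x≼x⊕y _ _)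

  f½x≼x : ∀ x → f½ x ≼ x
  f½x≼x x = ∼-cancel-≼ (subst (∼ x ≼_) ∼f½x (x≼f½x⊕½ (∼ x)))
    where
    ∼f½x : f½ (∼ x) ⊕ ½ ≡ ∼ (f½ x)
    ∼f½x = begin
      f½ (∼ x) ⊕ ½              ≡⟨ ⊕-comm _ _ ⟩
      ½ ⊕ f½ (∼ x)              ≡⟨ sym (∼-involutive _) ⟩
      ∼ (∼ (½ ⊕ f½ (∼ x)))      ≡⟨ cong ∼_ (sym (f½-∼ (∼ x))) ⟩
      ∼ (f½ (∼ (∼ x)))          ≡⟨ cong (λ t → ∼ (f½ t)) (∼-involutive x) ⟩
      ∼ (f½ x)                  ∎

  f½x⊕f½x≡x : ∀ x → f½ x ⊕ f½ x ≡ x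
  f½x⊕f½x≡x x = begin
    f½ x ⊕ f½ x          ≡⟨ cong (f½ x ⊕_) (sym x⊖f½x≡f½x) ⟩
    f½ x ⊕ (x ⊖ f½ x)    ≡⟨ x⊕[y⊖x]≡y (f½x≼x x) ⟩
    x                    ∎
    where
    x⊖f½x≡f½x : x ⊖ f½ x ≡ f½ x
    x⊖f½x≡f½x = begin
      x ⊖ f½ x                    ≡⟨ sym (⊕-identityʳ _) ⟩
      (x ⊖ f½ x) ⊕ 𝟘              ≡⟨ cong ((x ⊖ f½ x) ⊕_) (sym (≼⇒≤ (f½x≼x x))) ⟩
      (x ⊖ f½ x) ⊕ (f½ x ⊖ x)     ≡⟨ d[x,f½x]≡f½x x ⟩
      f½ x                        ∎

  f½-subadditive : ∀ x y → f½ (x ⊕ y) ≼ f½ x ⊕ f½ y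
  f½-subadditive x y = ⊖≼⇒≼⊕ (subst (_≼ f½ y) (A6 (x ⊕ y) x)
    (f½-mono-≼ (≼⊕⇒⊖≼ (≼-refl (x ⊕ y)))))

  δ≼f½-head⊕f½-δ-tail : ∀ x → δ x ≼ f½ (x zero) ⊕ f½ (δ (tailₛ x))
  δ≼f½-head⊕f½-δ-tail x =
    subst (λ t → δ x ≼ f½ (x zero) ⊕ t) (trans (A1 x) (A4 (tailₛ x)))
      (x≼y⊕d[x,y] (δ x) (f½ (x zero)))

  ½^_ : ℕ → Carrier
  ½^ zero  = 𝟙
  ½^ suc n = f½ (½^ n)

  Closure : Pred Carrier a → Pred Carrier a
  Closure I z = ∀ n → Σ[ m ∈ Carrier ] m ∈ I × z ≼ m ⊕ ½^ n

  ⊆-Closure : ∀ {I} → I ⊆ Closure I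
  ⊆-Closure {_} {m} m∈I n = m , m∈I , x≼x⊕y m (½^ n)

  module _ {I : Pred Carrier a} (I-ideal : IsIdeal A I) where
    open IsIdeal I-ideal

    Closure-isIdeal : IsIdeal A (Closure I)
    Closure-isIdeal = record
      { zero∈    = λ n → 𝟘 , zero∈ , ≼-minimum _
      ; down     = λ x≤y y∈ n → let (m , m∈I , y≼) = y∈ n in
                     m , m∈I , ≼-trans (≤⇒≼ x≤y) y≼
      ; ⊕-closed = closed
      }
      where
      closed : ∀ {x y} → x ∈ Closure I → y ∈ Closure I → x ⊕ y ∈ Closure I
      closed {x} {y} x∈ y∈ n =
        let (m₁ , m₁∈I , x≼) = x∈ (suc n)
            (m₂ , m₂∈I , y≼) = y∈ (suc n)
        in m₁ ⊕ m₂ , ⊕-closed m₁∈I m₂∈I ,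
           subst (x ⊕ y ≼_)
             (trans (interchange m₁ _ m₂ _) (cong ((m₁ ⊕ m₂) ⊕_) (f½x⊕f½x≡x (½^ n))))
             (⊕-mono-≼ x≼ y≼)

    Closure-isProper : IsProper A I → IsProper A (Closure I)
    Closure-isProper I-proper everything∈ with everything∈ 𝟙 1
    ... | m , m∈I , 𝟙≼m⊕½ = I-proper (λ z → down (≼⇒≤ (≼-maximum z)) 𝟙∈I)
      where
      ½≼m : ½ ≼ m
      ½≼m = trans (cong (_⊕ m) ∼½≡½) (trans (⊕-comm ½ m) (𝟙≼x⇒x≡𝟙 𝟙≼m⊕½))
      ½∈I : ½ ∈ I
      ½∈I = down (≼⇒≤ ½≼m) m∈I
      𝟙∈I : 𝟙 ∈ I
      𝟙∈I = subst (_∈ I) (f½x⊕f½x≡x 𝟙) (⊕-closed ½∈I ½∈I)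

    δ∈Closure : ∀ x → (∀ k → x k ∈ I) → δ x ∈ Closure I
    δ∈Closure x x∈I zero = 𝟘 , zero∈ , subst (δ x ≼_) (sym (⊕-identityˡ 𝟙)) (≼-maximum _)
    δ∈Closure x x∈I (suc n) =
      let (m , m∈I , δtail≼) = δ∈Closure (tailₛ x) (λ k → x∈I (suc k)) n
      in f½ (x zero) ⊕ f½ m ,
         ⊕-closed (down (≼⇒≤ (f½x≼x _)) (x∈I zero)) (down (≼⇒≤ (f½x≼x m)) m∈I) ,
         ≼-trans (δ≼f½-head⊕f½-δ-tail x)
           (subst (f½ (x zero) ⊕ f½ (δ (tailₛ x)) ≼_) (sym (⊕-assoc _ _ _))
             (⊕-mono-≼ (≼-refl _) (≼-trans (f½-mono-≼ δtail≼) (f½-subadditive m (½^ n)))))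

  Closure-⊆ : ∀ {M} → IsMaximalIdeal A M → Closure M ⊆ M
  Closure-⊆ {M} M-max =
    maximal (Closure M) (Closure-isIdeal ideal) ⊆-Closure (Closure-isProper ideal proper)
    where open IsMaximalIdeal M-max

lemma5p3 : ∀ {a : Level} (A : DeltaAlgebra a) (x : ℕ → DeltaAlgebra.Carrier A) →
             (∀ n → Rad A (x n)) → Rad A (DeltaAlgebra.δ A x)
lemma5p3 A x x∈Rad M M-max =
  Closure-⊆ A M-max (δ∈Closure A (IsMaximalIdeal.ideal M-max) x (λ k → x∈Rad k M M-max))
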